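{- Let $L$ be an atomic $0$-distributive lattice with at least three atoms. Then the strong metric dimension $\operatorname{sdim}_M(G^c(L))$ is finite if and only if the graph $G^c(L)$ is finite.
   Context: All lattices have a least element $0$. A lattice $L$ is $0$-distributive if $a\wedge b=0$ and $a\wedge c=0$ imply $a\wedge(b\vee c)=0$; it is atomic if every nonzero element lies above an atom (an element covering $0$). $Z^*(L)=\{a\in L\setminus\{0\}\mid a\wedge b=0 \text{ for some } b\neq 0\}$. The zero-divisor graph $G(L)$ has vertex set $Z^*(L)$, distinct $a,b$ adjacent iff $a\wedge b=0$; $G^c(L)$ is its complement: same vertex set, distinct $a,b$ adjacent iff $a\wedge b\neq 0$. In a connected graph $G$, a vertex $w$ strongly resolves vertices $u,v$ if some shortest $u$–$w$ path contains $v$ or some shortest $v$–$w$ path contains $u$. A set $W\subseteq V(G)$ is a strong resolving set if every pair of distinct vertices is strongly resolved by some vertex of $W$; $\operatorname{sdim}_M(G)$ is the minimum cardinality of a strong resolving set. -}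

module Defs where

open import Level using (Level; _⊔_) renaming (suc to lsuc)
open import Data.Nat using (ℕ; zero; suc; _≤_)
open import Data.Product using (Σ; ∃; ∃-syntax; _×_; _,_)
open import Data.Sum using (_⊎_)
open import Data.List using (List)
open import Data.List.Relation.Unary.All using (All)
open import Data.List.Relation.Unary.Any using (Any)
open import Relation.Nullary using (¬_)
open import Algebra.Lattice.Bundles using (Lattice)

record Lattice0 (c ℓ : Level) : Set (lsuc (c ⊔ ℓ)) where
  field
    lattice : Lattice c ℓ
  open Lattice lattice public
  field
    𝟘      : Carrier
    𝟘-least : ∀ x → (𝟘 ∧ x) ≈ 𝟘

module _ {c ℓ : Level} (L : Lattice0 c ℓ) where
  open Lattice0 L

  _≤L_ : Carrier → Carrier → Set ℓ
  a ≤L b = (a ∧ b) ≈ a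

  ZeroDistributive : Set (c ⊔ ℓ)
  ZeroDistributive = ∀ a b d → (a ∧ b) ≈ 𝟘 → (a ∧ d) ≈ 𝟘 → (a ∧ (b ∨ d)) ≈ 𝟘

  IsAtom : Carrier → Set (c ⊔ ℓ)
  IsAtom p = ¬ (p ≈ 𝟘) × (∀ x → x ≤L p → (x ≈ 𝟘) ⊎ (x ≈ p))

  Atomic : Set (c ⊔ ℓ)
  Atomic = ∀ a → ¬ (a ≈ 𝟘) → ∃[ p ] (IsAtom p × p ≤L a)

  AtLeastThreeAtoms : Set (c ⊔ ℓ)
  AtLeastThreeAtoms = ∃[ p ] ∃[ q ] ∃[ r ]
    (IsAtom p × IsAtom q × IsAtom r × ¬ (p ≈ q) × ¬ (p ≈ r) × ¬ (q ≈ r))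

  -- Z*(L): nonzero zero-divisors (vertex set of G^c(L))
  InZ* : Carrier → Set (c ⊔ ℓ)
  InZ* a = ¬ (a ≈ 𝟘) × ∃[ b ] (¬ (b ≈ 𝟘) × (a ∧ b) ≈ 𝟘)

  Adjᶜ : Carrier → Carrier → Set (c ⊔ ℓ)
  Adjᶜ a b = InZ* a × InZ* b × ¬ (a ≈ b) × ¬ ((a ∧ b) ≈ 𝟘)

  data Walk : Carrier → Carrier → ℕ → Set (c ⊔ ℓ) where
    here : ∀ {u} → InZ* u → Walk u u zero
    step : ∀ {u v w n} → Adjᶜ u v → Walk v w n → Walk u w (suc n)

  data OnWalk (x : Carrier) : ∀ {u w n} → Walk u w n → Set (c ⊔ ℓ) where
    on-here  : ∀ {u} {z : InZ* u} → x ≈ u → OnWalk x (here z)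
    on-start : ∀ {u v w n} {a : Adjᶜ u v} {p : Walk v w n} → x ≈ u → OnWalk x (step a p)
    on-later : ∀ {u v w n} {a : Adjᶜ u v} {p : Walk v w n} → OnWalk x p → OnWalk x (step a p)

  Shortest : ∀ {u w n} → Walk u w n → Set (c ⊔ ℓ)
  Shortest {u} {w} {n} _ = ∀ m → Walk u w m → n ≤ m

  StronglyResolves : Carrier → Carrier → Carrier → Set (c ⊔ ℓ)
  StronglyResolves w u v =
      (∃[ n ] Σ (Walk u w n) (λ p → Shortest p × OnWalk v p))
    ⊎ (∃[ n ] Σ (Walk v w n) (λ p → Shortest p × OnWalk u p))

  IsStrongResolvingSet : List Carrier → Set (c ⊔ ℓ)
  IsStrongResolvingSet W =
    All InZ* W ×
    (∀ u v → InZ* u → InZ* v → ¬ (u ≈ v) → Any (λ w → StronglyResolves w u v) W)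

  SdimFinite : Set (c ⊔ ℓ)
  SdimFinite = ∃[ W ] IsStrongResolvingSet W

  -- G^c(L) is finite: its vertex set Z*(L) is finite (up to ≈),
  -- i.e. covered by a finite list
  GraphFinite : Set (c ⊔ ℓ)
  GraphFinite = ∃[ xs ] (∀ z → InZ* z → Any (λ x → z ≈ x) xs)

{-# OPTIONS --safe #-}
module Submission where

-- Any two vertices u, w of G^c(L) are at distance at most 2: if u ∧ w = 0,
-- take atoms p ≤ u, q ≤ w and a third atom r; 0-distributivity gives
-- r ∧ (p ∨ q) = 0, so p ∨ q is a vertex adjacent to both. Hence if w strongly
-- resolves u and v, neither equal to w, say v lies on a shortest u–w path,
-- then that path is u – v – w, so w is adjacent to v but not to u. Vertices
-- outside a strong resolving set W are therefore determined by their
-- adjacency to W, so there are at most 2^|W| of them. Conversely every vertex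
-- strongly resolves itself from any other, so a finite vertex set resolves
-- itself.

open import Defs
open import Level using (Level; _⊔_; Lift; lift; lower)
open import Axiom.ExcludedMiddle using (ExcludedMiddle)
open import Data.Empty using (⊥-elim)
open import Data.Nat using (_≤_; _<_; z≤n; s≤s)
open import Data.Nat.Induction using (<-wellFounded)
open import Data.Nat.Properties using (≤-refl; ≤-trans; ≮⇒≥; n≮n)
open import Data.Product using (Σ; ∃; ∃-syntax; _×_; _,_; proj₁; proj₂)
open import Data.Sum using (_⊎_; inj₁; inj₂; [_,_]′)
open import Data.List using (List; []; _∷_; _++_; filter)
open import Data.List.Relation.Unary.All using (All; []; _∷_; lookupWith; zip)
open import Data.List.Relation.Unary.All.Properties using (¬Any⇒All¬; all-filter)
open import Data.List.Relation.Unary.Any using (Any; here)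
import Data.List.Relation.Unary.Any as Any
open import Data.List.Relation.Unary.Any.Properties using (++⁺ˡ; ++⁺ʳ; filter⁺; lookup-result)
open import Function using (_∘_; const)
open import Function.Bundles using (_⇔_; mk⇔; Equivalence)
open import Induction.WellFounded using (Acc; acc)
open import Relation.Binary.Bundles using (Setoid)
open import Relation.Binary.Definitions using (Decidable)
import Relation.Unary as U
open import Relation.Nullary using (¬_; yes; no)
open import Relation.Nullary.Decidable using (map′)
import Algebra.Lattice.Properties.Lattice as LatticeProperties
import Relation.Binary.Lattice as OrderLattice
import Relation.Binary.Properties.Setoid as SetoidProperties
import Relation.Binary.Reasoning.Setoid as SetoidReasoning

module _ {a ℓ} (S : Setoid a ℓ) (_≟_ : Decidable (Setoid._≈_ S)) where
  open Setoid S
  open SetoidProperties S using (≉-sym; ≉-respʳ)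

  avoid-two : ∀ {p} {P : Carrier → Set p} {a₁ a₂ a₃} → P a₁ → P a₂ → P a₃ →
              ¬ a₁ ≈ a₂ → ¬ a₁ ≈ a₃ → ¬ a₂ ≈ a₃ →
              ∀ x y → ∃[ r ] (P r × ¬ r ≈ x × ¬ r ≈ y)
  avoid-two {a₁ = a₁} {a₂} P₁ P₂ P₃ a₁≉a₂ a₁≉a₃ a₂≉a₃ x y with a₁ ≟ x | a₁ ≟ y | a₂ ≟ x | a₂ ≟ y
  ... | no a₁≉x  | no a₁≉y  | _        | _        = a₁ , P₁ , a₁≉x , a₁≉y
  ... | yes a₁≈x | _        | _        | no a₂≉y  = a₂ , P₂ , ≉-respʳ a₁≈x (≉-sym a₁≉a₂) , a₂≉y
  ... | yes a₁≈x | _        | _        | yes a₂≈y = _ , P₃ , ≉-respʳ a₁≈x (≉-sym a₁≉a₃) , ≉-respʳ a₂≈y (≉-sym a₂≉a₃)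
  ... | no _     | yes a₁≈y | no a₂≉x  | _        = a₂ , P₂ , a₂≉x , ≉-respʳ a₁≈y (≉-sym a₁≉a₂)
  ... | no _     | yes a₁≈y | yes a₂≈x | _        = _ , P₃ , ≉-respʳ a₂≈x (≉-sym a₂≉a₃) , ≉-respʳ a₁≈y (≉-sym a₁≉a₃)

module Profiles {a b p} {A : Set a} {B : Set b} (em : ExcludedMiddle (a ⊔ p))
         (R : A → B → Set (a ⊔ p)) where

  SameProfile : List B → A → A → Set (a ⊔ b ⊔ p)
  SameProfile ws u x = All (λ w → R u w ⇔ R x w) ws

  representatives : (A → Set (a ⊔ p)) → List B → List A
  representatives P [] with em {∃ P}
  ... | yes (x , _) = x ∷ []
  ... | no _        = []
  representatives P (w ∷ ws) =
    representatives (λ u → P u × R u w) ws ++ representatives (λ u → P u × ¬ R u w) ws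

  representative : ∀ (P : A → Set (a ⊔ p)) ws {u} → P u →
                   Any (λ x → P x × SameProfile ws u x) (representatives P ws)
  representative P [] {u} Pu with em {∃ P}
  ... | yes (x , Px) = here (Px , [])
  ... | no ∄P        = ⊥-elim (∄P (u , Pu))
  representative P (w ∷ ws) {u} Pu with em {R u w}
  ... | yes Ruw = ++⁺ˡ (Any.map (λ ((Px , Rxw) , same) → Px , mk⇔ (const Rxw) (const Ruw) ∷ same)
                                (representative _ ws (Pu , Ruw)))
  ... | no ¬Ruw = ++⁺ʳ (representatives _ ws)
                       (Any.map (λ ((Px , ¬Rxw) , same) → Px , mk⇔ (⊥-elim ∘ ¬Ruw) (⊥-elim ∘ ¬Rxw) ∷ same)
                                (representative _ ws (Pu , ¬Ruw)))

module LatticeFacts {c ℓ} (L : Lattice0 c ℓ) where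
  open Lattice0 L
  open OrderLattice.IsLattice (LatticeProperties.∨-∧-isOrderTheoreticLattice lattice)
    using (x≤x∨y; y≤x∨y; x∧y≤x; ∧-greatest)
  open SetoidReasoning setoid

  ≉𝟘-mono : ∀ {x y} → _≤L_ L x y → ¬ x ≈ 𝟘 → ¬ y ≈ 𝟘
  ≉𝟘-mono {x} {y} x≤y x≉𝟘 y≈𝟘 = x≉𝟘 (begin
    x      ≈⟨ x≤y ⟨
    x ∧ y  ≈⟨ ∧-cong refl y≈𝟘 ⟩
    x ∧ 𝟘  ≈⟨ ∧-comm x 𝟘 ⟩
    𝟘 ∧ x  ≈⟨ 𝟘-least x ⟩
    𝟘      ∎)

  ∧-≉𝟘 : ∀ {x y z} → ¬ x ≈ 𝟘 → _≤L_ L x y → _≤L_ L x z → ¬ (y ∧ z) ≈ 𝟘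
  ∧-≉𝟘 x≉𝟘 x≤y x≤z = ≉𝟘-mono (sym (∧-greatest (sym x≤y) (sym x≤z))) x≉𝟘

  ≤L-∨ˡ : ∀ x y → _≤L_ L x (x ∨ y)
  ≤L-∨ˡ x y = sym (x≤x∨y x y)

  ≤L-∨ʳ : ∀ x y → _≤L_ L y (x ∨ y)
  ≤L-∨ʳ x y = sym (y≤x∨y x y)

  distinct-atoms-∧≈𝟘 : ∀ {p q} → IsAtom L p → IsAtom L q → ¬ p ≈ q → (p ∧ q) ≈ 𝟘
  distinct-atoms-∧≈𝟘 {p} {q} (p≉𝟘 , below-p) (_ , below-q) p≉q
    with below-p (p ∧ q) (sym (x∧y≤x p q))
  ... | inj₁ p∧q≈𝟘 = p∧q≈𝟘
  ... | inj₂ p∧q≈p with below-q p p∧q≈p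
  ...   | inj₁ p≈𝟘 = ⊥-elim (p≉𝟘 p≈𝟘)
  ...   | inj₂ p≈q = ⊥-elim (p≉q p≈q)

module Walks {c ℓ} (L : Lattice0 c ℓ) where
  open Lattice0 L

  InZ*-cong : ∀ {x y} → x ≈ y → InZ* L x → InZ* L y
  InZ*-cong x≈y (x≉𝟘 , z , z≉𝟘 , x∧z≈𝟘) =
    x≉𝟘 ∘ trans x≈y , z , z≉𝟘 , trans (∧-cong (sym x≈y) refl) x∧z≈𝟘

  Adjᶜ-congˡ : ∀ {x x′ y} → x ≈ x′ → Adjᶜ L x y → Adjᶜ L x′ y
  Adjᶜ-congˡ x≈x′ (x∈Z* , y∈Z* , x≉y , x∧y≉𝟘) =
    InZ*-cong x≈x′ x∈Z* , y∈Z* , x≉y ∘ trans x≈x′ , x∧y≉𝟘 ∘ trans (∧-cong x≈x′ refl)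

  walk-start : ∀ {u w n} → Walk L u w n → InZ* L u
  walk-start (here u∈Z*)        = u∈Z*
  walk-start (step (u∈Z* , _) _) = u∈Z*

  walk-end : ∀ {u w n} → Walk L u w n → InZ* L w
  walk-end (here w∈Z*) = w∈Z*
  walk-end (step _ p)  = walk-end p

  on-walk-end : ∀ {x u w n} (p : Walk L u w n) → x ≈ w → OnWalk L x p
  on-walk-end (here _)   x≈w = on-here x≈w
  on-walk-end (step _ p) x≈w = on-later (on-walk-end p x≈w)

  on-shortest≤2⇒separates : ∀ {u v w n} (p : Walk L u w n) → Shortest L p → n ≤ 2 →
                            OnWalk L v p → ¬ u ≈ v → ¬ v ≈ w → Adjᶜ L v w × ¬ Adjᶜ L u w
  on-shortest≤2⇒separates (here _) _ _ (on-here v≈u) u≉v _ = ⊥-elim (u≉v (sym v≈u))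
  on-shortest≤2⇒separates (step _ _) _ _ (on-start v≈u) u≉v _ = ⊥-elim (u≉v (sym v≈u))
  on-shortest≤2⇒separates (step _ (here _)) _ _ (on-later (on-here v≈w)) _ v≉w = ⊥-elim (v≉w v≈w)
  on-shortest≤2⇒separates (step _ (step _ (here _))) _ _ (on-later (on-later (on-here v≈w))) _ v≉w =
    ⊥-elim (v≉w v≈w)
  on-shortest≤2⇒separates (step _ (step m-w (here w∈Z*))) shortest _ (on-later (on-start v≈m)) _ _ =
    Adjᶜ-congˡ (sym v≈m) m-w , λ u-w → n≮n 1 (shortest 1 (step u-w (here w∈Z*)))
  on-shortest≤2⇒separates (step _ (step _ (step _ _))) _ (s≤s (s≤s ())) _ _ _

  module Classical (em : ExcludedMiddle (c ⊔ ℓ)) where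

    ≈-dec : Decidable _≈_
    ≈-dec x y = map′ lower lift (em {Lift c (x ≈ y)})

    shortest-walk : ∀ {u w n} → Walk L u w n → ∃[ m ] Σ (Walk L u w m) (Shortest L)
    shortest-walk = descend (<-wellFounded _)
      where
      descend : ∀ {u w n} → Acc _<_ n → Walk L u w n → ∃[ m ] Σ (Walk L u w m) (Shortest L)
      descend {u} {w} {n} (acc shorter) p with em {∃[ m ] (m < n × Walk L u w m)}
      ... | yes (m , m<n , q) = descend (shorter m<n) q
      ... | no ∄shorter       = n , p , λ m q → ≮⇒≥ (λ m<n → ∄shorter (m , m<n , q))

    endpoint-resolves : ∀ {u v w n} → u ≈ w → Walk L v w n → StronglyResolves L w u v
    endpoint-resolves u≈w q with shortest-walk q
    ... | m , p , shortest = inj₂ (m , p , shortest , on-walk-end p u≈w)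

module ComplementGraph {c ℓ} (em : ExcludedMiddle (c ⊔ ℓ)) (L : Lattice0 c ℓ)
  (atomic : Atomic L) (zd : ZeroDistributive L) (three : AtLeastThreeAtoms L) where
  open Lattice0 L
  open LatticeFacts L
  open Walks L
  open Walks.Classical L em
  open Profiles {p = ℓ} em (Adjᶜ L)

  third-atom : ∀ x y → ∃[ r ] (IsAtom L r × ¬ r ≈ x × ¬ r ≈ y)
  third-atom =
    let _ , _ , _ , p-atom , q-atom , r-atom , p≉q , p≉r , q≉r = three
    in avoid-two setoid ≈-dec p-atom q-atom r-atom p≉q p≉r q≉r

  join-of-atoms-∈Z* : ∀ {p q} → IsAtom L p → IsAtom L q → InZ* L (p ∨ q)
  join-of-atoms-∈Z* {p} {q} p-atom q-atom with third-atom p q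
  ... | r , r-atom , r≉p , r≉q =
    ≉𝟘-mono (≤L-∨ˡ p q) (proj₁ p-atom) , r , proj₁ r-atom ,
    trans (∧-comm (p ∨ q) r)
          (zd r p q (distinct-atoms-∧≈𝟘 r-atom p-atom r≉p) (distinct-atoms-∧≈𝟘 r-atom q-atom r≉q))

  common-neighbour : ∀ {u w} → InZ* L u → InZ* L w → (u ∧ w) ≈ 𝟘 →
                     ∃[ m ] (Adjᶜ L u m × Adjᶜ L m w)
  common-neighbour {u} {w} u∈Z* w∈Z* u∧w≈𝟘 with atomic u (proj₁ u∈Z*) | atomic w (proj₁ w∈Z*)
  ... | p , p-atom , p≤u | q , q-atom , q≤w =
    p ∨ q , (u∈Z* , m∈Z* , u≉m , u∧m≉𝟘) , (m∈Z* , w∈Z* , m≉w , m∧w≉𝟘)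
    where
    m∈Z* : InZ* L (p ∨ q)
    m∈Z* = join-of-atoms-∈Z* p-atom q-atom
    u∧m≉𝟘 : ¬ (u ∧ (p ∨ q)) ≈ 𝟘
    u∧m≉𝟘 = ∧-≉𝟘 (proj₁ p-atom) p≤u (≤L-∨ˡ p q)
    m∧w≉𝟘 : ¬ ((p ∨ q) ∧ w) ≈ 𝟘
    m∧w≉𝟘 = ∧-≉𝟘 (proj₁ q-atom) (≤L-∨ʳ p q) q≤w
    u≉m : ¬ u ≈ (p ∨ q)
    u≉m u≈m = m∧w≉𝟘 (trans (∧-cong (sym u≈m) refl) u∧w≈𝟘)
    m≉w : ¬ (p ∨ q) ≈ w
    m≉w m≈w = u∧m≉𝟘 (trans (∧-cong refl m≈w) u∧w≈𝟘)

  walk≤2 : ∀ {u w} → InZ* L u → InZ* L w → ¬ u ≈ w → ∃[ n ] (n ≤ 2 × Walk L u w n)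
  walk≤2 {u} {w} u∈Z* w∈Z* u≉w with ≈-dec (u ∧ w) 𝟘
  ... | no u∧w≉𝟘 = 1 , s≤s z≤n , step (u∈Z* , w∈Z* , u≉w , u∧w≉𝟘) (here w∈Z*)
  ... | yes u∧w≈𝟘 with common-neighbour u∈Z* w∈Z* u∧w≈𝟘
  ...   | _ , u-m , m-w = 2 , ≤-refl , step u-m (step m-w (here w∈Z*))

  shortest≤2 : ∀ {u w n} (p : Walk L u w n) → Shortest L p → ¬ u ≈ w → n ≤ 2
  shortest≤2 p shortest u≉w with walk≤2 (walk-start p) (walk-end p) u≉w
  ... | k , k≤2 , q = ≤-trans (shortest k q) k≤2

  resolver-separates : ∀ {u v w} → ¬ u ≈ v → ¬ u ≈ w → ¬ v ≈ w →
                       StronglyResolves L w u v → ¬ (Adjᶜ L u w ⇔ Adjᶜ L v w)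
  resolver-separates u≉v u≉w v≉w (inj₁ (_ , p , shortest , v∈p)) u-w⇔v-w
    with on-shortest≤2⇒separates p shortest (shortest≤2 p shortest u≉w) v∈p u≉v v≉w
  ... | v-w , ¬u-w = ¬u-w (Equivalence.from u-w⇔v-w v-w)
  resolver-separates u≉v u≉w v≉w (inj₂ (_ , p , shortest , u∈p)) u-w⇔v-w
    with on-shortest≤2⇒separates p shortest (shortest≤2 p shortest v≉w) u∈p (u≉v ∘ sym) u≉w
  ... | u-w , ¬v-w = ¬v-w (Equivalence.to u-w⇔v-w u-w)

  self-resolves : ∀ {u v w} → InZ* L u → InZ* L v → ¬ u ≈ v → u ≈ w → StronglyResolves L w u v
  self-resolves u∈Z* v∈Z* u≉v u≈w
    with walk≤2 v∈Z* (InZ*-cong u≈w u∈Z*) (λ v≈w → u≉v (trans u≈w (sym v≈w)))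
  ... | _ , _ , q = endpoint-resolves u≈w q

  outside-determined-by-profile : ∀ {W} → IsStrongResolvingSet L W → ∀ {u x} →
                                  InZ* L u → InZ* L x →
                                  All (λ w → ¬ u ≈ w) W → All (λ w → ¬ x ≈ w) W →
                                  SameProfile W u x → u ≈ x
  outside-determined-by-profile (_ , resolving) {u} {x} u∈Z* x∈Z* u∉W x∉W same with ≈-dec u x
  ... | yes u≈x = u≈x
  ... | no u≉x  = ⊥-elim (lookupWith (λ (u-w⇔x-w , u≉w , x≉w) r → resolver-separates u≉x u≉w x≉w r u-w⇔x-w)
                                     (zip (same , zip (u∉W , x∉W)))
                                     (resolving u x u∈Z* x∈Z* u≉x))

  sdim-finite⇒graph-finite : SdimFinite L → GraphFinite L
  sdim-finite⇒graph-finite (W , W-resolving) = W ++ representatives Outside W , covered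
    where
    Outside : Carrier → Set (c ⊔ ℓ)
    Outside u = InZ* L u × All (λ w → ¬ u ≈ w) W
    covered : ∀ z → InZ* L z → Any (z ≈_) (W ++ representatives Outside W)
    covered z z∈Z* with em {Any (z ≈_) W}
    ... | yes z∈W = ++⁺ˡ z∈W
    ... | no z∉W  = ++⁺ʳ W (Any.map (λ ((x∈Z* , x∉W) , same) →
                                      outside-determined-by-profile W-resolving z∈Z* x∈Z* z∉W′ x∉W same)
                                   (representative Outside W (z∈Z* , z∉W′)))
      where
      z∉W′ : All (λ w → ¬ z ≈ w) W
      z∉W′ = ¬Any⇒All¬ W z∉W

  graph-finite⇒sdim-finite : GraphFinite L → SdimFinite L
  graph-finite⇒sdim-finite (xs , covers) = filter InZ*? xs , all-filter InZ*? xs , resolved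
    where
    InZ*? : U.Decidable (InZ* L)
    InZ*? _ = em
    resolved : ∀ u v → InZ* L u → InZ* L v → ¬ u ≈ v →
               Any (λ w → StronglyResolves L w u v) (filter InZ*? xs)
    resolved u v u∈Z* v∈Z* u≉v =
      [ Any.map proj₂ , (λ ¬InZ* → ⊥-elim (¬InZ* (proj₁ (lookup-result located)))) ]′
      (filter⁺ InZ*? located)
      where
      located : Any (λ x → InZ* L x × StronglyResolves L x u v) xs
      located = Any.map (λ u≈x → InZ*-cong u≈x u∈Z* , self-resolves u∈Z* v∈Z* u≉v u≈x) (covers u u∈Z*)

corollary3p3 : {c ℓ : Level} → ExcludedMiddle (c ⊔ ℓ) → (L : Lattice0 c ℓ)
    → Atomic L → ZeroDistributive L → AtLeastThreeAtoms L
    → (SdimFinite L → GraphFinite L) × (GraphFinite L → SdimFinite L)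
corollary3p3 em L atomic zd three = sdim-finite⇒graph-finite , graph-finite⇒sdim-finite
  where open ComplementGraph em L atomic zd three
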